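{- Let $\mathcal{F}$ be a union-closed family of finite sets with $\emptyset\in\mathcal{F}$, let $U\subseteq\bigcup\mathcal{F}$, and let $D$ be a finite set with $D\supseteq\bigcup\mathcal{F}$. There exists an extension $\mathcal{F}'=\mathcal{F}\vee\mathcal{H}$ of $(\mathcal{F},U)$ such that (i) $\mathcal{H}$ is a nonempty order filter (up-set) of the Boolean lattice $2^{D\setminus U}$; (ii) $\mathcal{F}'_{\setminus U}=\mathcal{H}$; (iii) $\mathcal{F}'$ minimizes $\mu$ in $D$.
   Context: For families $\mathcal{A},\mathcal{B}$ of sets, $\mathcal{A}\vee\mathcal{B}=\{A\cup B:A\in\mathcal{A},B\in\mathcal{B}\}$, and $\mathcal{A}_{\setminus Z}=\{A\setminus Z:A\in\mathcal{A}\}$. $\pi_{\mathcal{F}}(X)=\bigcup\{V\in\mathcal{F}:V\subseteq X\}$. A union-closed family $\mathcal{F}'$ is an extension of $(\mathcal{F},U)$ if $\mathcal{F}'=\mathcal{F}\vee\mathcal{H}$ for a nonempty union-closed family $\mathcal{H}$ with $(\bigcup\mathcal{H})\cap U=\emptyset$. For $X$ with $X\cap U=\emptyset$, $E(X)$ is the set of $Y\subseteq U$ with $\pi_{\mathcal{F}}(X\cup Y)\cap U=Y$ and $\pi_{\mathcal{F}}(X\cup Y)\supseteq\pi_{\mathcal{F}}(X\cup U)\setminus U$. For an extension $\mathcal{F}'$, $\mu_{\mathcal{F}'}=\sum_{X\in\mathcal{F}'_{\setminus U}}|E(X)|\,/\,|\mathcal{F}'_{\setminus U}|$. An extension $\mathcal{F}'$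 of $(\mathcal{F},U)$ minimizes $\mu$ in $D$ if $\bigcup\mathcal{F}'\subseteq D$ and $\mu_{\mathcal{F}'}\le\mu_{\mathcal{F}''}$ for every extension $\mathcal{F}''$ of $(\mathcal{F},U)$ with $\bigcup\mathcal{F}''\subseteq D$. -}

module Defs where

open import Data.Nat using (ℕ; zero; suc; _*_; _≤_)
open import Data.Bool using (Bool; true; false; _∧_; if_then_else_)
import Data.Bool.Properties as BoolP
open import Data.Fin.Subset using (Subset; _∪_; _∩_; _─_; _⊆_; ⊥; inside; outside)
open import Data.Fin.Subset.Properties using (_⊆?_)
open import Data.Vec using (_∷_; [])
import Data.Vec.Properties as VecP
open import Data.List using (List; []; _∷_; map; filter; foldr; length; _++_)
open import Data.Bool.ListAction using (any)
open import Data.Nat.ListAction using (sum)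
open import Data.Product using (Σ; _×_; ∃)
open import Relation.Binary.PropositionalEquality using (_≡_)
open import Relation.Nullary.Decidable using (⌊_⌋; does)
open import Relation.Binary.Definitions using (DecidableEquality)

-- Convention: the ground set D is Fin n; sets are subsets of D (Subset n),
-- and a family of sets is given by its characteristic function on 2^D.
Family : ℕ → Set
Family n = Subset n → Bool

_∈F_ : {n : ℕ} → Subset n → Family n → Set
X ∈F 𝓕 = 𝓕 X ≡ true

infix 4 _∈F_ _≟S_

_≟S_ : {n : ℕ} → DecidableEquality (Subset n)
_≟S_ = VecP.≡-dec BoolP._≟_

subsets : (n : ℕ) → List (Subset n)
subsets zero = [] ∷ []
subsets (suc n) = map (outside ∷_) (subsets n) ++ map (inside ∷_) (subsets n)

members : {n : ℕ} → Family n → List (Subset n)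
members {n} 𝓕 = filter (λ X → 𝓕 X Data.Bool.≟ true) (subsets n)

card : {n : ℕ} → Family n → ℕ
card 𝓕 = length (members 𝓕)

bigUnion : {n : ℕ} → Family n → Subset n
bigUnion 𝓕 = foldr _∪_ ⊥ (members 𝓕)

UnionClosed : {n : ℕ} → Family n → Set
UnionClosed 𝓕 = ∀ A B → A ∈F 𝓕 → B ∈F 𝓕 → (A ∪ B) ∈F 𝓕

NonemptyFamily : {n : ℕ} → Family n → Set
NonemptyFamily 𝓕 = ∃ λ X → X ∈F 𝓕

_∨F_ : {n : ℕ} → Family n → Family n → Family n
(𝓐 ∨F 𝓑) X = any (λ A → any (λ B → does ((A ∪ B) ≟S X)) (members 𝓑)) (members 𝓐)

_∖F_ : {n : ℕ} → Family n → Subset n → Family n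
(𝓐 ∖F Z) X = any (λ A → does ((A ─ Z) ≟S X)) (members 𝓐)

π : {n : ℕ} → Family n → Subset n → Subset n
π {n} 𝓕 X = foldr _∪_ ⊥ (filter (λ V → V ⊆? X) (members 𝓕))

ExtensionFamily : {n : ℕ} → Family n → Subset n → Family n → Set
ExtensionFamily 𝓕 U 𝓗 = NonemptyFamily 𝓗 × UnionClosed 𝓗 × (bigUnion 𝓗 ∩ U ≡ ⊥)

inE : {n : ℕ} → Family n → Subset n → Subset n → Subset n → Bool
inE 𝓕 U X Y =
  does (Y ⊆? U) ∧ (does ((π 𝓕 (X ∪ Y) ∩ U) ≟S Y) ∧ does ((π 𝓕 (X ∪ U) ─ U) ⊆? π 𝓕 (X ∪ Y)))

cardE : {n : ℕ} → Family n → Subset n → Subset n → ℕ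
cardE {n} 𝓕 U X = length (filter (λ Y → inE 𝓕 U X Y Data.Bool.≟ true) (subsets n))

μnum : {n : ℕ} → Family n → Subset n → Family n → ℕ
μnum 𝓕 U 𝓕' = sum (map (cardE 𝓕 U) (members (𝓕' ∖F U)))

μden : {n : ℕ} → Family n → Subset n → Family n → ℕ
μden 𝓕 U 𝓕' = card (𝓕' ∖F U)

-- μ_{𝓕₁} ≤ μ_{𝓕₂}, i.e. num₁/den₁ ≤ num₂/den₂ (denominators are positive
-- for extensions), written by cross-multiplication
μ≤ : {n : ℕ} → Family n → Subset n → Family n → Family n → Set
μ≤ 𝓕 U 𝓕₁ 𝓕₂ = μnum 𝓕 U 𝓕₁ * μden 𝓕 U 𝓕₂ ≤ μnum 𝓕 U 𝓕₂ * μden 𝓕 U 𝓕₁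

-- 𝓕 ∨ 𝓗 minimizes μ in D (= Fin n) among all extensions of (𝓕,U)
-- (the condition ⋃𝓕'' ⊆ D holds automatically since everything lives in Fin n)
MinimizesMu : {n : ℕ} → Family n → Subset n → Family n → Set
MinimizesMu 𝓕 U 𝓗 = ∀ 𝓗'' → ExtensionFamily 𝓕 U 𝓗'' → μ≤ 𝓕 U (𝓕 ∨F 𝓗) (𝓕 ∨F 𝓗'')

UpSetOfComplement : {n : ℕ} → Subset n → Family n → Set
UpSetOfComplement U 𝓗 =
  (∀ X → X ∈F 𝓗 → X ∩ U ≡ ⊥) ×
  (∀ X Y → X ∈F 𝓗 → X ⊆ Y → Y ∩ U ≡ ⊥ → Y ∈F 𝓗)

-- For an up-set 𝓗 of 2^(D ∖ U) we have (𝓕 ∨ 𝓗) ∖ U = 𝓗 (as ∅ ∈ 𝓕), so μ of 𝓕 ∨ 𝓗 is the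
-- average of |E| over 𝓗; take 𝓗* minimising this average among the finitely many such 𝓗.
-- Given any extension, let G = (𝓕 ∨ 𝓗) ∖ U: it is union-closed and closed under
-- g ↦ g ∪ (V ∖ U) for V ∈ 𝓕. Every Z in the up-set of G then has a largest member ⌊Z⌋ of G
-- below it, and |E(Z)| = |E(⌊Z⌋)|. Hence the up-set generated by an up-set 𝒜 of G has
-- average Σ_{g∈𝒜} λ(g)|E(g)| / Σ_{g∈𝒜} λ(g), where λ(g) is the size of the fibre of g, and
-- this is at least μ(𝓗*). Since λ is antitone, 1/λ is a positive combination of indicators
-- of up-sets of G (its level sets), and summing the inequalities with these weights yields
-- μ(𝓗*) ≤ Σ_{g∈G} |E(g)| / |G|. The weights are scaled to N!/λ to stay within ℕ.

module Submission where

open import Defs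
open import Data.Nat using (ℕ)
open import Data.Fin.Subset using (Subset; _⊆_; ⊥)
open import Data.Product using (Σ; _×_)
open import Relation.Binary.PropositionalEquality using (_≡_)

open import Algebra.Bundles using (CommutativeMonoid)
open import Data.Bool using (Bool; true; false; _∧_; if_then_else_)
import Data.Bool as Bool
open import Data.Bool.ListAction using (any)
open import Data.Bool.Properties using (∧-conicalˡ; ∧-conicalʳ)
open import Data.Empty using (⊥-elim)
import Data.Fin as Fin
open import Data.Fin.Subset using (_∪_; _∩_; _─_; ∁; inside; outside; _∈_; _∉_)
open import Data.Fin.Subset.Properties using (_⊆?_)
import Data.Fin.Subset.Properties as SP
import Data.Integer as ℤ
import Data.Integer.Properties as ℤP
open import Data.List using (List; []; _∷_; map; filter; foldr; length; _++_)
open import Data.List.Membership.Propositional using () renaming (_∈_ to _∈ₗ_)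
open import Data.List.Membership.Propositional.Properties using (∈-++⁺ˡ; ∈-++⁺ʳ; ∈-map⁺; ∈-filter⁺; ∈-filter⁻)
open import Data.List.Properties using (filter-≐)
open import Data.List.Relation.Unary.Any using (here; there)
import Data.List.Relation.Unary.All as All
import Data.Nat as ℕ
open import Data.Nat using (zero; suc; pred; _+_; _*_; _≤_; _∸_; _≤?_; z≤n; s≤s; _!)
import Data.Nat.Properties as ℕP
open import Data.Nat.Divisibility using (_∣_; ∣-trans; m∣m*n; m≤n⇒m!∣n!)
open import Data.Nat.DivMod using (_/_; m*[n/m]≡n; m/n≤m; /-monoʳ-≤)
open import Data.Nat.ListAction using (sum)
open import Data.Product using (_,_; proj₁; proj₂; ∃)
open import Data.Rational.Unnormalised using (ℚᵘ; mkℚᵘ; *≤*) renaming (_≤_ to _≤ᵘ_)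
import Data.Rational.Unnormalised.Properties as ℚᵘP
open import Data.List.Extrema ℚᵘP.≤-totalOrder using (argmin; f[argmin]≤f[xs])
open import Data.Sum using (_⊎_; inj₁; inj₂; [_,_])
open import Data.Vec using ([]; _∷_)
import Data.Vec as V
open import Function using (_∘_)
open import Relation.Nullary using (Dec; yes; no; does)
open import Relation.Nullary.Decidable using (dec-true)
open import Relation.Binary.PropositionalEquality
  using (refl; sym; trans; cong; cong₂; subst; subst₂; module ≡-Reasoning)

does⇒ : ∀ {p} {P : Set p} (P? : Dec P) → does P? ≡ true → P
does⇒ (yes p) _ = p

∧-intro : ∀ {a b} → a ≡ true → b ≡ true → a ∧ b ≡ true
∧-intro refl refl = refl

≡true-ext : ∀ {a b} → (a ≡ true → b ≡ true) → (b ≡ true → a ≡ true) → a ≡ b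
≡true-ext {true}  {true}  _ _ = refl
≡true-ext {true}  {false} f _ = sym (f refl)
≡true-ext {false} {true}  _ g = g refl
≡true-ext {false} {false} _ _ = refl

any⁺ : ∀ {a} {A : Set a} (p : A → Bool) {xs : List A} {x} → x ∈ₗ xs → p x ≡ true → any p xs ≡ true
any⁺ p (here refl) px rewrite px = refl
any⁺ p {y ∷ _} (there x∈) px with p y
... | true  = refl
... | false = any⁺ p x∈ px

any⁻ : ∀ {a} {A : Set a} (p : A → Bool) (xs : List A) → any p xs ≡ true → ∃ λ x → x ∈ₗ xs × p x ≡ true
any⁻ p (y ∷ xs) h with p y in py
... | true  = y , here refl , py
... | false = let x , x∈ , px = any⁻ p xs h in x , there x∈ , px

when : Bool → ℕ → ℕ
when b m = if b then m else 0

when-zero : ∀ b → when b 0 ≡ 0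
when-zero true  = refl
when-zero false = refl

∑ₗ : ∀ {a} {A : Set a} → List A → (A → ℕ) → ℕ
∑ₗ xs f = sum (map f xs)

module _ {a} {A : Set a} where

  ∑ₗ-cong : ∀ (xs : List A) {f g : A → ℕ} → (∀ x → f x ≡ g x) → ∑ₗ xs f ≡ ∑ₗ xs g
  ∑ₗ-cong []       _ = refl
  ∑ₗ-cong (x ∷ xs) e = cong₂ _+_ (e x) (∑ₗ-cong xs e)

  ∑ₗ-mono : ∀ (xs : List A) {f g : A → ℕ} → (∀ x → f x ≤ g x) → ∑ₗ xs f ≤ ∑ₗ xs g
  ∑ₗ-mono []       _ = z≤n
  ∑ₗ-mono (x ∷ xs) e = ℕP.+-mono-≤ (e x) (∑ₗ-mono xs e)

  ∑ₗ-zero : ∀ (xs : List A) {f : A → ℕ} → (∀ x → f x ≡ 0) → ∑ₗ xs f ≡ 0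
  ∑ₗ-zero []       _ = refl
  ∑ₗ-zero (x ∷ xs) e rewrite e x = ∑ₗ-zero xs e

  ∑ₗ-+ : ∀ (xs : List A) (f g : A → ℕ) → ∑ₗ xs (λ x → f x + g x) ≡ ∑ₗ xs f + ∑ₗ xs g
  ∑ₗ-+ []       _ _ = refl
  ∑ₗ-+ (x ∷ xs) f g = trans (cong (f x + g x +_) (∑ₗ-+ xs f g))
                            (+-interchange (f x) (g x) (∑ₗ xs f) (∑ₗ xs g))
    where open import Algebra.Properties.CommutativeSemigroup ℕP.+-commutativeSemigroup
            using () renaming (interchange to +-interchange)

  *-distribˡ-∑ₗ : ∀ (xs : List A) (k : ℕ) (f : A → ℕ) → k * ∑ₗ xs f ≡ ∑ₗ xs (λ x → k * f x)
  *-distribˡ-∑ₗ []       k _ = ℕP.*-zeroʳ k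
  *-distribˡ-∑ₗ (x ∷ xs) k f = trans (ℕP.*-distribˡ-+ k (f x) _) (cong (k * f x +_) (*-distribˡ-∑ₗ xs k f))

  ∑ₗ-++ : ∀ (xs ys : List A) (f : A → ℕ) → ∑ₗ (xs ++ ys) f ≡ ∑ₗ xs f + ∑ₗ ys f
  ∑ₗ-++ []       _  _ = refl
  ∑ₗ-++ (x ∷ xs) ys f = trans (cong (f x +_) (∑ₗ-++ xs ys f)) (sym (ℕP.+-assoc (f x) _ _))

  ∑ₗ-count≤length : ∀ (xs : List A) (b : A → Bool) → ∑ₗ xs (λ x → when (b x) 1) ≤ length xs
  ∑ₗ-count≤length []       _ = z≤n
  ∑ₗ-count≤length (x ∷ xs) b with b x
  ... | true  = s≤s (∑ₗ-count≤length xs b)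
  ... | false = ℕP.m≤n⇒m≤1+n (∑ₗ-count≤length xs b)

  ∑ₗ-filter : ∀ (xs : List A) (b : A → Bool) (f : A → ℕ) →
              ∑ₗ (filter (λ x → b x Bool.≟ true) xs) f ≡ ∑ₗ xs (λ x → when (b x) (f x))
  ∑ₗ-filter []       _ _ = refl
  ∑ₗ-filter (x ∷ xs) b f with b x
  ... | true  = cong (f x +_) (∑ₗ-filter xs b f)
  ... | false = ∑ₗ-filter xs b f

  ∑ₗ-when≡0⊎∃ : ∀ (xs : List A) (b : A → Bool) (f : A → ℕ) →
                ∑ₗ xs (λ x → when (b x) (f x)) ≡ 0 ⊎ ∃ λ x → b x ≡ true
  ∑ₗ-when≡0⊎∃ []       _ _ = inj₁ refl
  ∑ₗ-when≡0⊎∃ (x ∷ xs) b f with b x in bx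
  ... | true  = inj₂ (x , bx)
  ... | false = ∑ₗ-when≡0⊎∃ xs b f

∑ₗ-map : ∀ {a b} {A : Set a} {B : Set b} (xs : List A) (g : A → B) (f : B → ℕ) →
         ∑ₗ (map g xs) f ≡ ∑ₗ xs (λ x → f (g x))
∑ₗ-map []       _ _ = refl
∑ₗ-map (x ∷ xs) g f = cong (f (g x) +_) (∑ₗ-map xs g f)

∑ₗ-swap : ∀ {a b} {A : Set a} {B : Set b} (xs : List A) (ys : List B) (f : A → B → ℕ) →
          ∑ₗ xs (λ x → ∑ₗ ys (f x)) ≡ ∑ₗ ys (λ y → ∑ₗ xs (λ x → f x y))
∑ₗ-swap []       ys f = sym (∑ₗ-zero ys (λ _ → refl))
∑ₗ-swap (x ∷ xs) ys f = trans (cong (∑ₗ ys (f x) +_) (∑ₗ-swap xs ys f)) (sym (∑ₗ-+ ys (f x) _))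

length≡∑ₗ1 : ∀ {a} {A : Set a} (xs : List A) → length xs ≡ ∑ₗ xs (λ _ → 1)
length≡∑ₗ1 []       = refl
length≡∑ₗ1 (_ ∷ xs) = cong suc (length≡∑ₗ1 xs)

∑ : ∀ {n} → (Subset n → ℕ) → ℕ
∑ {n} f = ∑ₗ (subsets n) f

∑ᶠ : ∀ {n} → Family n → (Subset n → ℕ) → ℕ
∑ᶠ 𝓐 f = ∑ (λ X → when (𝓐 X) (f X))

∈-subsets : ∀ {n} (X : Subset n) → X ∈ₗ subsets n
∈-subsets []                 = here refl
∈-subsets {suc n} (false ∷ X) = ∈-++⁺ˡ (∈-map⁺ (outside ∷_) (∈-subsets X))
∈-subsets {suc n} (true ∷ X)  = ∈-++⁺ʳ (map (outside ∷_) (subsets n)) (∈-map⁺ (inside ∷_) (∈-subsets X))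

∑-δ : ∀ {n} (A : Subset n) (h : Subset n → ℕ) → ∑ (λ Y → when (does (Y ≟S A)) (h Y)) ≡ h A
∑-δ {zero} [] h = ℕP.+-identityʳ (h [])
∑-δ {suc n} (a ∷ A) h = begin
  ∑ₗ (map (outside ∷_) (subsets n) ++ map (inside ∷_) (subsets n)) δh
    ≡⟨ ∑ₗ-++ (map (outside ∷_) (subsets n)) _ δh ⟩
  ∑ₗ (map (outside ∷_) (subsets n)) δh + ∑ₗ (map (inside ∷_) (subsets n)) δh
    ≡⟨ cong₂ _+_ (∑ₗ-map (subsets n) (outside ∷_) δh) (∑ₗ-map (subsets n) (inside ∷_) δh) ⟩
  ∑ (λ Y → δh (outside ∷ Y)) + ∑ (λ Y → δh (inside ∷ Y))
    ≡⟨ split a ⟩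
  h (a ∷ A) ∎
  where
  open ≡-Reasoning
  δh : Subset (suc n) → ℕ
  δh Y = when (does (Y ≟S (a ∷ A))) (h Y)
  split : ∀ a → ∑ (λ Y → when (does ((outside ∷ Y) ≟S (a ∷ A))) (h (outside ∷ Y)))
              + ∑ (λ Y → when (does ((inside ∷ Y) ≟S (a ∷ A))) (h (inside ∷ Y))) ≡ h (a ∷ A)
  split false = trans (cong₂ _+_ (∑-δ A (λ Y → h (outside ∷ Y))) (∑ₗ-zero (subsets n) (λ _ → refl)))
                      (ℕP.+-identityʳ _)
  split true  = cong₂ _+_ (∑ₗ-zero (subsets n) (λ _ → refl)) (∑-δ A (λ Y → h (inside ∷ Y)))

term≤∑ : ∀ {n} (f : Subset n → ℕ) (A : Subset n) → f A ≤ ∑ f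
term≤∑ {n} f A = subst (_≤ ∑ f) (∑-δ A f) (∑ₗ-mono (subsets n) λ Y → when≤ (does (Y ≟S A)) (f Y))
  where
  when≤ : ∀ b m → when b m ≤ m
  when≤ true  _ = ℕP.≤-refl
  when≤ false _ = z≤n

∑-fibres : ∀ {n} (φ : Subset n → Subset n) (F : Subset n → Subset n → ℕ) →
           ∑ (λ Z → F Z (φ Z)) ≡ ∑ (λ g → ∑ (λ Z → when (does (g ≟S φ Z)) (F Z g)))
∑-fibres {n} φ F = trans (∑ₗ-cong (subsets n) (λ Z → sym (∑-δ (φ Z) (F Z))))
                         (∑ₗ-swap (subsets n) (subsets n) _)

∈-members⁺ : ∀ {n} (𝓐 : Family n) {X} → X ∈F 𝓐 → X ∈ₗ members 𝓐
∈-members⁺ 𝓐 {X} = ∈-filter⁺ (λ X → 𝓐 X Bool.≟ true) (∈-subsets X)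

∈-members⁻ : ∀ {n} (𝓐 : Family n) {X} → X ∈ₗ members 𝓐 → X ∈F 𝓐
∈-members⁻ {n} 𝓐 X∈ = proj₂ (∈-filter⁻ (λ X → 𝓐 X Bool.≟ true) {xs = subsets n} X∈)

∑ₗ-members : ∀ {n} (𝓐 : Family n) (f : Subset n → ℕ) → ∑ₗ (members 𝓐) f ≡ ∑ᶠ 𝓐 f
∑ₗ-members {n} 𝓐 = ∑ₗ-filter (subsets n) 𝓐

card≡∑ᶠ : ∀ {n} (𝓐 : Family n) → card 𝓐 ≡ ∑ᶠ 𝓐 (λ _ → 1)
card≡∑ᶠ 𝓐 = trans (length≡∑ₗ1 (members 𝓐)) (∑ₗ-members 𝓐 _)

∑ᶠ-cong : ∀ {n} (𝓐 : Family n) {f g : Subset n → ℕ} →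
          (∀ X → X ∈F 𝓐 → f X ≡ g X) → ∑ᶠ 𝓐 f ≡ ∑ᶠ 𝓐 g
∑ᶠ-cong {n} 𝓐 e = ∑ₗ-cong (subsets n) pointwise
  where
  pointwise : ∀ X → when (𝓐 X) _ ≡ when (𝓐 X) _
  pointwise X with 𝓐 X in X∈
  ... | true  = e X X∈
  ... | false = refl

∑ᶠ-congᶠ : ∀ {n} {𝓐 𝓑 : Family n} (f : Subset n → ℕ) → (∀ X → 𝓐 X ≡ 𝓑 X) → ∑ᶠ 𝓐 f ≡ ∑ᶠ 𝓑 f
∑ᶠ-congᶠ {n} f e = ∑ₗ-cong (subsets n) (λ X → cong (λ b → when b (f X)) (e X))

*-distribˡ-∑ᶠ : ∀ {n} (𝓐 : Family n) (k : ℕ) (f : Subset n → ℕ) → k * ∑ᶠ 𝓐 f ≡ ∑ᶠ 𝓐 (λ X → k * f X)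
*-distribˡ-∑ᶠ {n} 𝓐 k f = trans (*-distribˡ-∑ₗ (subsets n) k _) (∑ₗ-cong (subsets n) pointwise)
  where
  pointwise : ∀ X → k * when (𝓐 X) (f X) ≡ when (𝓐 X) (k * f X)
  pointwise X with 𝓐 X
  ... | true  = refl
  ... | false = ℕP.*-zeroʳ k

∑ᶠ≡0⊎nonempty : ∀ {n} (𝓐 : Family n) (f : Subset n → ℕ) → ∑ᶠ 𝓐 f ≡ 0 ⊎ NonemptyFamily 𝓐
∑ᶠ≡0⊎nonempty {n} 𝓐 f = ∑ₗ-when≡0⊎∃ (subsets n) 𝓐 f

count-≤-injection : ∀ {n} (𝓐 𝓑 : Family n) (φ ψ : Subset n → Subset n) →
                    (∀ Z → Z ∈F 𝓐 → φ Z ∈F 𝓑 × ψ (φ Z) ≡ Z) → ∑ᶠ 𝓐 (λ _ → 1) ≤ ∑ᶠ 𝓑 (λ _ → 1)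
count-≤-injection {n} 𝓐 𝓑 φ ψ inj = begin
  ∑ (λ Z → when (𝓐 Z) 1)
    ≡⟨ ∑-fibres φ (λ Z _ → when (𝓐 Z) 1) ⟩
  ∑ (λ W → ∑ (λ Z → when (does (W ≟S φ Z)) (when (𝓐 Z) 1)))
    ≤⟨ ∑ₗ-mono (subsets n) (λ W → ∑ₗ-mono (subsets n) (pointwise W)) ⟩
  ∑ (λ W → ∑ (λ Z → when (does (Z ≟S ψ W)) (when (𝓑 W) 1)))
    ≡⟨ ∑ₗ-cong (subsets n) (λ W → ∑-δ (ψ W) (λ _ → when (𝓑 W) 1)) ⟩
  ∑ (λ W → when (𝓑 W) 1) ∎
  where
  open ℕP.≤-Reasoning
  pointwise : ∀ W Z → when (does (W ≟S φ Z)) (when (𝓐 Z) 1) ≤ when (does (Z ≟S ψ W)) (when (𝓑 W) 1)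
  pointwise W Z with W ≟S φ Z | 𝓐 Z in Z∈
  ... | no _     | _     = z≤n
  ... | yes _    | false = z≤n
  ... | yes refl | true  rewrite proj₁ (inj Z Z∈) | proj₂ (inj Z Z∈) | dec-true (Z ≟S Z) refl = ℕP.≤-refl

x∈p─q⇒x∉q : ∀ {n} (p q : Subset n) {x} → x ∈ p ─ q → x ∉ q
x∈p─q⇒x∉q (_ ∷ p) (inside ∷ q) {Fin.zero} () V.here
x∈p─q⇒x∉q (_ ∷ p) (_ ∷ q) {Fin.suc x} (V.there x∈) (V.there x∈q) = x∈p─q⇒x∉q p q x∈ x∈q

module _ {n : ℕ} where

  ∪-least : ∀ {p q r : Subset n} → p ⊆ r → q ⊆ r → p ∪ q ⊆ r
  ∪-least {p} {q} p⊆r q⊆r x∈ with SP.x∈p∪q⁻ p q x∈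
  ... | inj₁ x∈p = p⊆r x∈p
  ... | inj₂ x∈q = q⊆r x∈q

  ∪-monoˡ-⊆ : ∀ {p q} (r : Subset n) → p ⊆ q → p ∪ r ⊆ q ∪ r
  ∪-monoˡ-⊆ {q = q} r p⊆q = ∪-least (λ x∈ → SP.p⊆p∪q r (p⊆q x∈)) (SP.q⊆p∪q q r)

  disjoint⇒∉ : ∀ {X U : Subset n} → X ∩ U ≡ ⊥ → ∀ {x} → x ∈ X → x ∉ U
  disjoint⇒∉ {X} {U} X∩U {x} x∈X x∈U = SP.∉⊥ (subst (x ∈_) X∩U (SP.x∈p∩q⁺ (x∈X , x∈U)))

  ∉⇒disjoint : ∀ {X U : Subset n} → (∀ {x} → x ∈ X → x ∉ U) → X ∩ U ≡ ⊥
  ∉⇒disjoint {X} {U} h = SP.Empty-unique λ (x , x∈) → let x∈X , x∈U = SP.x∈p∩q⁻ X U x∈ in h x∈X x∈U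

  ⊆-disjoint : ∀ {X Y U : Subset n} → X ⊆ Y → Y ∩ U ≡ ⊥ → X ∩ U ≡ ⊥
  ⊆-disjoint X⊆Y Y∩U = ∉⇒disjoint (λ x∈ → disjoint⇒∉ Y∩U (X⊆Y x∈))

  ∪-disjoint : ∀ {X Y U : Subset n} → X ∩ U ≡ ⊥ → Y ∩ U ≡ ⊥ → (X ∪ Y) ∩ U ≡ ⊥
  ∪-disjoint {X} {Y} X∩U Y∩U = ∉⇒disjoint λ x∈ → [ disjoint⇒∉ X∩U , disjoint⇒∉ Y∩U ] (SP.x∈p∪q⁻ X Y x∈)

  ─-disjoint : ∀ (X U : Subset n) → (X ─ U) ∩ U ≡ ⊥
  ─-disjoint X U = ∉⇒disjoint (x∈p─q⇒x∉q X U)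

  ∁-disjoint : ∀ (U : Subset n) → ∁ U ∩ U ≡ ⊥
  ∁-disjoint U = ∉⇒disjoint SP.x∈∁p⇒x∉p

  disjoint⇒⊆∁ : ∀ {X U : Subset n} → X ∩ U ≡ ⊥ → X ⊆ ∁ U
  disjoint⇒⊆∁ X∩U x∈ = SP.x∉p⇒x∈∁p (disjoint⇒∉ X∩U x∈)

  disjoint⇒─≡ : ∀ {X U : Subset n} → X ∩ U ≡ ⊥ → X ─ U ≡ X
  disjoint⇒─≡ {X} {U} X∩U =
    SP.⊆-antisym (SP.p─q⊆p X U) (λ x∈ → SP.x∈p∧x∉q⇒x∈p─q x∈ (disjoint⇒∉ X∩U x∈))

  ⊆∪⇒─⊆ : ∀ {V Z U : Subset n} → V ⊆ Z ∪ U → V ─ U ⊆ Z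
  ⊆∪⇒─⊆ {V} {Z} {U} V⊆Z∪U x∈ =
    [ (λ x∈Z → x∈Z) , (λ x∈U → ⊥-elim (x∈p─q⇒x∉q V U x∈ x∈U)) ]
      (SP.x∈p∪q⁻ Z U (V⊆Z∪U (SP.p─q⊆p V U x∈)))

  ∪-─-∩⊆ : ∀ (X Y Z : Subset n) {x} → x ∈ X ∪ (Z ─ Y) → x ∈ Y → x ∈ X
  ∪-─-∩⊆ X Y Z x∈ x∈Y =
    [ (λ x∈X → x∈X) , (λ x∈Z─Y → ⊥-elim (x∈p─q⇒x∉q Z Y x∈Z─Y x∈Y)) ] (SP.x∈p∪q⁻ X (Z ─ Y) x∈)

  ∪-─-∪-cancel : ∀ {X Y Z : Subset n} → X ⊆ Y → Y ⊆ Z → (X ∪ (Z ─ Y)) ∪ Y ≡ Z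
  ∪-─-∪-cancel {X} {Y} {Z} X⊆Y Y⊆Z = SP.⊆-antisym (∪-least (∪-least (Y⊆Z ∘ X⊆Y) (SP.p─q⊆p Z Y)) Y⊆Z) Z⊆
    where
    Z⊆ : Z ⊆ (X ∪ (Z ─ Y)) ∪ Y
    Z⊆ {x} x∈Z with x SP.∈? Y
    ... | yes x∈Y = SP.q⊆p∪q _ Y x∈Y
    ... | no  x∉Y = SP.p⊆p∪q Y (SP.q⊆p∪q X (Z ─ Y) (SP.x∈p∧x∉q⇒x∈p─q x∈Z x∉Y))

∪-distribʳ-─ : ∀ {n} (X Y U : Subset n) → (X ∪ Y) ─ U ≡ (X ─ U) ∪ (Y ─ U)
∪-distribʳ-─ []      []      []           = refl
∪-distribʳ-─ (_ ∷ X) (_ ∷ Y) (inside ∷ U)  = cong (outside ∷_) (∪-distribʳ-─ X Y U)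
∪-distribʳ-─ (x ∷ X) (y ∷ Y) (outside ∷ U) = cong ((x Bool.∨ y) ∷_) (∪-distribʳ-─ X Y U)

⋃ : ∀ {n} → List (Subset n) → Subset n
⋃ = foldr _∪_ ⊥

module _ {n : ℕ} where

  ⊆-⋃ : ∀ {X : Subset n} {Xs} → X ∈ₗ Xs → X ⊆ ⋃ Xs
  ⊆-⋃ {Xs = Y ∷ _}  (here refl) = SP.p⊆p∪q _
  ⊆-⋃ {Xs = Y ∷ Xs} (there X∈)  = SP.q⊆p∪q Y (⋃ Xs) ∘ ⊆-⋃ X∈

  ⋃-⊆ : ∀ (Xs : List (Subset n)) {Z} → (∀ X → X ∈ₗ Xs → X ⊆ Z) → ⋃ Xs ⊆ Z
  ⋃-⊆ []       _ x∈ = ⊥-elim (SP.∉⊥ x∈)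
  ⋃-⊆ (Y ∷ Xs) h   = ∪-least (h Y (here refl)) (⋃-⊆ Xs (λ X X∈ → h X (there X∈)))

  ⋃-∈F : ∀ {𝓐 : Family n} {Y} → UnionClosed 𝓐 →
         ∀ Xs → Y ∈ₗ Xs → (∀ X → X ∈ₗ Xs → X ∈F 𝓐) → ⋃ Xs ∈F 𝓐
  ⋃-∈F {𝓐} _  (X ∷ [])     _ h = subst (_∈F 𝓐) (sym (SP.∪-identityʳ X)) (h X (here refl))
  ⋃-∈F     uc (X ∷ Y ∷ Xs) _ h = uc X _ (h X (here refl)) (⋃-∈F uc (Y ∷ Xs) (here refl) (λ Z Z∈ → h Z (there Z∈)))

module _ {n : ℕ} where

  ∈-∨F⁺ : ∀ (𝓐 𝓑 : Family n) {A B} → A ∈F 𝓐 → B ∈F 𝓑 → A ∪ B ∈F 𝓐 ∨F 𝓑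
  ∈-∨F⁺ 𝓐 𝓑 {A} {B} A∈ B∈ =
    any⁺ _ (∈-members⁺ 𝓐 A∈)
      (any⁺ (λ B′ → does ((A ∪ B′) ≟S (A ∪ B))) (∈-members⁺ 𝓑 B∈) (dec-true ((A ∪ B) ≟S (A ∪ B)) refl))

  ∈-∨F⁻ : ∀ (𝓐 𝓑 : Family n) {X} → X ∈F 𝓐 ∨F 𝓑 →
          ∃ λ A → ∃ λ B → A ∈F 𝓐 × B ∈F 𝓑 × A ∪ B ≡ X
  ∈-∨F⁻ 𝓐 𝓑 X∈ =
    let A , A∈ , h = any⁻ _ (members 𝓐) X∈
        B , B∈ , e = any⁻ _ (members 𝓑) h
    in A , B , ∈-members⁻ 𝓐 A∈ , ∈-members⁻ 𝓑 B∈ , does⇒ (_ ≟S _) e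

  ∈-∖F⁺ : ∀ (𝓐 : Family n) (Z : Subset n) {A} → A ∈F 𝓐 → A ─ Z ∈F 𝓐 ∖F Z
  ∈-∖F⁺ 𝓐 Z {A} A∈ = any⁺ _ (∈-members⁺ 𝓐 A∈) (dec-true ((A ─ Z) ≟S (A ─ Z)) refl)

  ∈-∖F⁻ : ∀ (𝓐 : Family n) (Z : Subset n) {X} → X ∈F 𝓐 ∖F Z → ∃ λ A → A ∈F 𝓐 × A ─ Z ≡ X
  ∈-∖F⁻ 𝓐 Z X∈ = let A , A∈ , e = any⁻ _ (members 𝓐) X∈ in A , ∈-members⁻ 𝓐 A∈ , does⇒ (_ ≟S _) e

-- Invariance of |E(X)|

module _ {n : ℕ} (𝓕 : Family n) where

  π-mono : ∀ {A B : Subset n} → (∀ V → V ∈F 𝓕 → V ⊆ A → V ⊆ B) → π 𝓕 A ⊆ π 𝓕 B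
  π-mono {A} {B} h = ⋃-⊆ (filter (_⊆? A) (members 𝓕)) λ V V∈ →
    let V∈𝓕 , V⊆A = ∈-filter⁻ (_⊆? A) {xs = members 𝓕} V∈
    in ⊆-⋃ (∈-filter⁺ (_⊆? B) V∈𝓕 (h V (∈-members⁻ 𝓕 V∈𝓕) V⊆A))

  cardE-cong : ∀ (U : Subset n) {X Z} → X ⊆ Z → Z ∩ U ≡ ⊥ →
               (∀ V → V ∈F 𝓕 → V ⊆ Z ∪ U → V ⊆ X ∪ U) → cardE 𝓕 U X ≡ cardE 𝓕 U Z
  cardE-cong U {X} {Z} X⊆Z Z∩U V⊆X∪U =
    cong length (filter-≐ (λ Y → inE 𝓕 U X Y Bool.≟ true) (λ Y → inE 𝓕 U Z Y Bool.≟ true)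
                          ((λ {Y} → subst (_≡ true) (inE-cong Y)) , (λ {Y} → subst (_≡ true) (sym (inE-cong Y))))
                          (subsets n))
    where
    shrink : ∀ Y → Y ⊆ U → ∀ V → V ∈F 𝓕 → V ⊆ Z ∪ Y → V ⊆ X ∪ Y
    shrink Y Y⊆U V V∈ V⊆Z∪Y {x} x∈V
      with SP.x∈p∪q⁻ X U (V⊆X∪U V V∈ (∪-least (SP.p⊆p∪q U) (SP.q⊆p∪q Z U ∘ Y⊆U) ∘ V⊆Z∪Y) x∈V)
    ... | inj₁ x∈X = SP.p⊆p∪q Y x∈X
    ... | inj₂ x∈U =
      [ (λ x∈Z → ⊥-elim (disjoint⇒∉ Z∩U x∈Z x∈U)) , SP.q⊆p∪q X Y ] (SP.x∈p∪q⁻ Z Y (V⊆Z∪Y x∈V))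
    π-∪-cong : ∀ Y → Y ⊆ U → π 𝓕 (X ∪ Y) ≡ π 𝓕 (Z ∪ Y)
    π-∪-cong Y Y⊆U = SP.⊆-antisym (π-mono λ V _ V⊆ → ∪-monoˡ-⊆ Y X⊆Z ∘ V⊆) (π-mono (shrink Y Y⊆U))
    inE-cong : ∀ Y → inE 𝓕 U X Y ≡ inE 𝓕 U Z Y
    inE-cong Y with Y ⊆? U
    ... | yes Y⊆U rewrite π-∪-cong Y Y⊆U | π-∪-cong U (λ x∈ → x∈) = refl
    ... | no _    = refl

-- Up-sets of 2^(D ∖ U)

module _ {n : ℕ} (U : Subset n) where

  upClosure : List (Subset n) → Family n
  upClosure Gs Y = does ((Y ∩ U) ≟S ⊥) ∧ any (λ X → does (X ⊆? Y)) Gs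

  upClosure⁺ : ∀ {Gs X Y} → Y ∩ U ≡ ⊥ → X ∈ₗ Gs → X ⊆ Y → Y ∈F upClosure Gs
  upClosure⁺ {Y = Y} Y∩U X∈ X⊆Y =
    ∧-intro (dec-true ((Y ∩ U) ≟S ⊥) Y∩U) (any⁺ (λ X → does (X ⊆? Y)) X∈ (dec-true (_ ⊆? Y) X⊆Y))

  upClosure⁻ : ∀ Gs {Y} → Y ∈F upClosure Gs → Y ∩ U ≡ ⊥ × ∃ λ X → X ∈ₗ Gs × X ⊆ Y
  upClosure⁻ Gs {Y} Y∈ =
    let X , X∈ , X⊆Y = any⁻ (λ X → does (X ⊆? Y)) Gs (∧-conicalʳ _ _ Y∈)
    in does⇒ ((Y ∩ U) ≟S ⊥) (∧-conicalˡ _ _ Y∈) , X , X∈ , does⇒ (X ⊆? Y) X⊆Y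

  upClosure-upSet : ∀ Gs → UpSetOfComplement U (upClosure Gs)
  upClosure-upSet Gs = (λ X X∈ → proj₁ (upClosure⁻ Gs X∈)) , up
    where
    up : ∀ X Y → X ∈F upClosure Gs → X ⊆ Y → Y ∩ U ≡ ⊥ → Y ∈F upClosure Gs
    up X Y X∈ X⊆Y Y∩U = let _ , W , W∈ , W⊆X = upClosure⁻ Gs X∈ in upClosure⁺ Y∩U W∈ (X⊆Y ∘ W⊆X)

  upSet⇒extension : ∀ (𝓕 𝓗 : Family n) → UpSetOfComplement U 𝓗 → NonemptyFamily 𝓗 → ExtensionFamily 𝓕 U 𝓗
  upSet⇒extension 𝓕 𝓗 (disjoint , up) nonempty = nonempty , unionClosed , ⋃-disjoint
    where
    unionClosed : UnionClosed 𝓗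
    unionClosed A B A∈ B∈ = up A (A ∪ B) A∈ (SP.p⊆p∪q B) (∪-disjoint (disjoint A A∈) (disjoint B B∈))
    ⋃-disjoint : bigUnion 𝓗 ∩ U ≡ ⊥
    ⋃-disjoint = ∉⇒disjoint λ x∈ →
      SP.x∈∁p⇒x∉p (⋃-⊆ (members 𝓗) (λ X X∈ → disjoint⇒⊆∁ (disjoint X (∈-members⁻ 𝓗 X∈))) x∈)

  ∨F-∖F-upSet : ∀ (𝓕 𝓗 : Family n) → ⊥ ∈F 𝓕 → UpSetOfComplement U 𝓗 →
                ∀ X → ((𝓕 ∨F 𝓗) ∖F U) X ≡ 𝓗 X
  ∨F-∖F-upSet 𝓕 𝓗 ⊥∈𝓕 (disjoint , up) X = ≡true-ext to from
    where
    to : X ∈F (𝓕 ∨F 𝓗) ∖F U → X ∈F 𝓗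
    to X∈ with ∈-∖F⁻ (𝓕 ∨F 𝓗) U X∈
    ... | _ , A∈ , refl with ∈-∨F⁻ 𝓕 𝓗 A∈
    ...   | F , H , _ , H∈ , refl =
      up H _ H∈ (λ x∈ → SP.x∈p∧x∉q⇒x∈p─q (SP.q⊆p∪q F H x∈) (disjoint⇒∉ (disjoint H H∈) x∈))
         (─-disjoint (F ∪ H) U)
    from : X ∈F 𝓗 → X ∈F (𝓕 ∨F 𝓗) ∖F U
    from X∈ = subst (_∈F (𝓕 ∨F 𝓗) ∖F U) (trans (cong (_─ U) (SP.∪-identityˡ X)) (disjoint⇒─≡ (disjoint X X∈)))
                    (∈-∖F⁺ (𝓕 ∨F 𝓗) U (∈-∨F⁺ 𝓕 𝓗 ⊥∈𝓕 X∈))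

sublists : ∀ {a} {A : Set a} → List A → List (List A)
sublists []       = [] ∷ []
sublists (x ∷ xs) = map (x ∷_) (sublists xs) ++ sublists xs

filter-∈-sublists : ∀ {a p} {A : Set a} {P : A → Set p} (P? : ∀ x → Dec (P x)) (xs : List A) →
                    filter P? xs ∈ₗ sublists xs
filter-∈-sublists P? []       = here refl
filter-∈-sublists P? (x ∷ xs) with does (P? x)
... | true  = ∈-++⁺ˡ (∈-map⁺ (x ∷_) (filter-∈-sublists P? xs))
... | false = ∈-++⁺ʳ (map (x ∷_) (sublists xs)) (filter-∈-sublists P? xs)

-- mkℚᵘ (ℤ.+ a) (pred b) is a / b as long as b is positive.
mkℚᵘ-≤⇒*-≤ : ∀ {a b c d} → 1 ≤ b → 1 ≤ d →
              mkℚᵘ (ℤ.+ a) (pred b) ≤ᵘ mkℚᵘ (ℤ.+ c) (pred d) → a * d ≤ c * b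
mkℚᵘ-≤⇒*-≤ {a} {suc b} {c} {suc d} _ _ (*≤* ad≤cb) =
  ℤ.drop‿+≤+ (subst₂ ℤ._≤_ (sym (ℤP.pos-* a (suc d))) (sym (ℤP.pos-* c (suc b))) ad≤cb)

∣-! : ∀ {m k} → 1 ≤ m → m ≤ k → m ∣ k !
∣-! {suc m} _ m≤k = ∣-trans (m∣m*n (m !)) (m≤n⇒m!∣n! m≤k)

-- Layer-cake summation

UpSetIn : ∀ {n} → Family n → Family n → Set
UpSetIn G 𝒜 = (∀ g → g ∈F 𝒜 → g ∈F G) × (∀ g g′ → g ∈F 𝒜 → g′ ∈F G → g ⊆ g′ → g′ ∈F 𝒜)

module _ {n : ℕ} (G : Family n) (a b : ℕ) (w v : Subset n → ℕ)
         (upSet-bound : ∀ 𝒜 → UpSetIn G 𝒜 → a * ∑ᶠ 𝒜 w ≤ b * ∑ᶠ 𝒜 v) where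

  -- ν is the sum of the indicators of its level sets {ν ≥ j}, each an up-set in G.
  layer-cake : ∀ k (ν : Subset n → ℕ) → (∀ g g′ → g ∈F G → g′ ∈F G → g ⊆ g′ → ν g ≤ ν g′) →
               (∀ g → ν g ≤ k) →
               a * ∑ᶠ G (λ g → w g * ν g) ≤ b * ∑ᶠ G (λ g → v g * ν g)
  layer-cake zero ν _ ν≤0 =
    subst (_≤ b * ∑ᶠ G (λ g → v g * ν g)) (sym (trans (cong (a *_) vanish) (ℕP.*-zeroʳ a))) z≤n
    where
    vanish : ∑ᶠ G (λ g → w g * ν g) ≡ 0
    vanish = ∑ₗ-zero (subsets n) λ g →
      trans (cong (when (G g)) (trans (cong (w g *_) (ℕP.n≤0⇒n≡0 (ν≤0 g))) (ℕP.*-zeroʳ (w g)))) (when-zero (G g))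
  layer-cake (suc k) ν ν-mono ν≤1+k = begin
    a * ∑ᶠ G (λ g → w g * ν g)                   ≡⟨ cong (a *_) (peel w) ⟩
    a * (∑ᶠ level w + ∑ᶠ G (λ g → w g * ν′ g))   ≡⟨ ℕP.*-distribˡ-+ a _ _ ⟩
    a * ∑ᶠ level w + a * ∑ᶠ G (λ g → w g * ν′ g)
      ≤⟨ ℕP.+-mono-≤ (upSet-bound level level-upSet) (layer-cake k ν′ ν′-mono ν′≤k) ⟩
    b * ∑ᶠ level v + b * ∑ᶠ G (λ g → v g * ν′ g) ≡⟨ sym (ℕP.*-distribˡ-+ b _ _) ⟩
    b * (∑ᶠ level v + ∑ᶠ G (λ g → v g * ν′ g))   ≡⟨ cong (b *_) (sym (peel v)) ⟩
    b * ∑ᶠ G (λ g → v g * ν g)                   ∎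
    where
    open ℕP.≤-Reasoning
    level : Family n
    level g = G g ∧ does (1 ≤? ν g)
    ν′ : Subset n → ℕ
    ν′ g = ν g ∸ 1
    peel-when : ∀ c x m → when c (x * m) ≡ when (c ∧ does (1 ≤? m)) x + when c (x * (m ∸ 1))
    peel-when false _ _       = refl
    peel-when true  _ zero    = refl
    peel-when true  x (suc m) = ℕP.*-suc x m
    peel : ∀ f → ∑ᶠ G (λ g → f g * ν g) ≡ ∑ᶠ level f + ∑ᶠ G (λ g → f g * ν′ g)
    peel f = trans (∑ₗ-cong (subsets n) (λ g → peel-when (G g) (f g) (ν g))) (∑ₗ-+ (subsets n) _ _)
    level-upSet : UpSetIn G level
    level-upSet = (λ g g∈ → ∧-conicalˡ _ _ g∈) , up
      where
      up : ∀ g g′ → g ∈F level → g′ ∈F G → g ⊆ g′ → g′ ∈F level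
      up g g′ g∈ g′∈G g⊆g′ = ∧-intro g′∈G (dec-true (1 ≤? ν g′)
        (ℕP.≤-trans (does⇒ (1 ≤? ν g) (∧-conicalʳ _ _ g∈)) (ν-mono g g′ (∧-conicalˡ _ _ g∈) g′∈G g⊆g′)))
    ν′-mono : ∀ g g′ → g ∈F G → g′ ∈F G → g ⊆ g′ → ν′ g ≤ ν′ g′
    ν′-mono g g′ g∈ g′∈ g⊆g′ = ℕP.∸-monoˡ-≤ 1 (ν-mono g g′ g∈ g′∈ g⊆g′)
    ν′≤k : ∀ g → ν′ g ≤ k
    ν′≤k g = ℕP.∸-monoˡ-≤ 1 (ν≤1+k g)

-- Traces of extensions

module _ {n : ℕ} (𝓕 𝓗 : Family n) (U : Subset n) where

  private
    open import Algebra.Properties.CommutativeSemigroup (CommutativeMonoid.commutativeSemigroup (SP.∪-commutativeMonoid n))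
      using () renaming (interchange to ∪-interchange; xy∙z≈xz∙y to ∪-swapʳ)

    ∈-trace⁻ : ∀ {X} → X ∈F (𝓕 ∨F 𝓗) ∖F U →
               ∃ λ F → ∃ λ H → F ∈F 𝓕 × H ∈F 𝓗 × (F ∪ H) ─ U ≡ X
    ∈-trace⁻ X∈ with ∈-∖F⁻ (𝓕 ∨F 𝓗) U X∈
    ... | _ , A∈ , refl with ∈-∨F⁻ 𝓕 𝓗 A∈
    ...   | F , H , F∈ , H∈ , refl = F , H , F∈ , H∈ , refl

    ∈-trace⁺ : ∀ {F H X} → F ∈F 𝓕 → H ∈F 𝓗 → (F ∪ H) ─ U ≡ X → X ∈F (𝓕 ∨F 𝓗) ∖F U
    ∈-trace⁺ F∈ H∈ refl = ∈-∖F⁺ (𝓕 ∨F 𝓗) U (∈-∨F⁺ 𝓕 𝓗 F∈ H∈)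

  trace-disjoint : ∀ X → X ∈F (𝓕 ∨F 𝓗) ∖F U → X ∩ U ≡ ⊥
  trace-disjoint X X∈ with ∈-trace⁻ X∈
  ... | F , H , _ , _ , refl = ─-disjoint (F ∪ H) U

  trace-unionClosed : UnionClosed 𝓕 → UnionClosed 𝓗 → UnionClosed ((𝓕 ∨F 𝓗) ∖F U)
  trace-unionClosed uc𝓕 uc𝓗 X Y X∈ Y∈ with ∈-trace⁻ X∈ | ∈-trace⁻ Y∈
  ... | F₁ , H₁ , F₁∈ , H₁∈ , refl | F₂ , H₂ , F₂∈ , H₂∈ , refl =
    ∈-trace⁺ (uc𝓕 F₁ F₂ F₁∈ F₂∈) (uc𝓗 H₁ H₂ H₁∈ H₂∈)
             (trans (cong (_─ U) (∪-interchange F₁ F₂ H₁ H₂)) (∪-distribʳ-─ (F₁ ∪ H₁) (F₂ ∪ H₂) U))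

  trace-absorbs : UnionClosed 𝓕 →
                  ∀ X V → X ∈F (𝓕 ∨F 𝓗) ∖F U → V ∈F 𝓕 → X ∪ (V ─ U) ∈F (𝓕 ∨F 𝓗) ∖F U
  trace-absorbs uc𝓕 X V X∈ V∈ with ∈-trace⁻ X∈
  ... | F , H , F∈ , H∈ , refl =
    ∈-trace⁺ (uc𝓕 F V F∈ V∈) H∈
             (trans (cong (_─ U) (∪-swapʳ F V H)) (∪-distribʳ-─ (F ∪ H) V U))

μnum≡∑ᶠ : ∀ {n} (𝓕 : Family n) (U : Subset n) (𝓕′ : Family n) →
          μnum 𝓕 U 𝓕′ ≡ ∑ᶠ (𝓕′ ∖F U) (cardE 𝓕 U)
μnum≡∑ᶠ 𝓕 U 𝓕′ = ∑ₗ-members (𝓕′ ∖F U) (cardE 𝓕 U)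

μden≡∑ᶠ : ∀ {n} (𝓕 : Family n) (U : Subset n) (𝓕′ : Family n) →
          μden 𝓕 U 𝓕′ ≡ ∑ᶠ (𝓕′ ∖F U) (λ _ → 1)
μden≡∑ᶠ 𝓕 U 𝓕′ = card≡∑ᶠ (𝓕′ ∖F U)

-- The extremal up-set

module Extremal {n : ℕ} (𝓕 : Family n) (U : Subset n) where

  e : Subset n → ℕ
  e = cardE 𝓕 U

  candidate : List (Subset n) → Family n
  candidate Gs = upClosure U (∁ U ∷ Gs)

  ∁U∈candidate : ∀ Gs → ∁ U ∈F candidate Gs
  ∁U∈candidate Gs = upClosure⁺ U {∁ U ∷ Gs} (∁-disjoint U) (here refl) (λ x∈ → x∈)

  num den : List (Subset n) → ℕ
  num Gs = ∑ᶠ (candidate Gs) e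
  den Gs = ∑ᶠ (candidate Gs) (λ _ → 1)

  den-pos : ∀ Gs → 1 ≤ den Gs
  den-pos Gs = subst (_≤ den Gs) (cong (λ b → when b 1) (∁U∈candidate Gs)) (term≤∑ (λ X → when (candidate Gs X) 1) (∁ U))

  μᵘ : List (Subset n) → ℚᵘ
  μᵘ Gs = mkℚᵘ (ℤ.+ num Gs) (pred (den Gs))

  best : List (Subset n)
  best = argmin μᵘ [] (sublists (subsets n))

  𝓗* : Family n
  𝓗* = candidate best

  best-minimal : ∀ (𝒜 : Family n) → num best * den (members 𝒜) ≤ num (members 𝒜) * den best
  best-minimal 𝒜 = mkℚᵘ-≤⇒*-≤ (den-pos best) (den-pos (members 𝒜))
    (All.lookup (f[argmin]≤f[xs] {f = μᵘ} [] (sublists (subsets n))) (filter-∈-sublists (λ X → 𝒜 X Bool.≟ true) (subsets n)))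

  module Comparison (G : Family n) (G-disjoint : ∀ X → X ∈F G → X ∩ U ≡ ⊥) (G-unionClosed : UnionClosed G)
                    (G-absorbs : ∀ X V → X ∈F G → V ∈F 𝓕 → X ∪ (V ─ U) ∈F G) where

    above : Family n
    above = upClosure U (members G)

    below : Subset n → List (Subset n)
    below Z = filter (_⊆? Z) (members G)

    ⌊_⌋ : Subset n → Subset n
    ⌊ Z ⌋ = ⋃ (below Z)

    ∈-below⁻ : ∀ {X Z} → X ∈ₗ below Z → X ∈F G × X ⊆ Z
    ∈-below⁻ {Z = Z} X∈ = let X∈G , X⊆Z = ∈-filter⁻ (_⊆? Z) {xs = members G} X∈ in ∈-members⁻ G X∈G , X⊆Z

    ⌊⌋-⊆ : ∀ Z → ⌊ Z ⌋ ⊆ Z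
    ⌊⌋-⊆ Z = ⋃-⊆ (below Z) (λ X X∈ → proj₂ (∈-below⁻ X∈))

    ⊆-⌊⌋ : ∀ {g Z} → g ∈F G → g ⊆ Z → g ⊆ ⌊ Z ⌋
    ⊆-⌊⌋ {Z = Z} g∈ g⊆Z = ⊆-⋃ (∈-filter⁺ (_⊆? Z) (∈-members⁺ G g∈) g⊆Z)

    ⌊⌋-mono : ∀ {Y Z} → Y ⊆ Z → ⌊ Y ⌋ ⊆ ⌊ Z ⌋
    ⌊⌋-mono {Y} Y⊆Z = ⋃-⊆ (below Y) λ X X∈ → let X∈G , X⊆Y = ∈-below⁻ X∈ in ⊆-⌊⌋ X∈G (Y⊆Z ∘ X⊆Y)

    ⌊⌋-∈ : ∀ {Z} → Z ∈F above → ⌊ Z ⌋ ∈F G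
    ⌊⌋-∈ {Z} Z∈ = let _ , g , g∈ , g⊆Z = upClosure⁻ U (members G) Z∈ in
      ⋃-∈F G-unionClosed (below Z) (∈-filter⁺ (_⊆? Z) g∈ g⊆Z) (λ X X∈ → proj₁ (∈-below⁻ X∈))

    ⌊⌋-self : ∀ {g} → g ∈F G → ⌊ g ⌋ ≡ g
    ⌊⌋-self {g} g∈ = SP.⊆-antisym (⌊⌋-⊆ g) (⊆-⌊⌋ g∈ (λ x∈ → x∈))

    ∈-above : ∀ {g} → g ∈F G → g ∈F above
    ∈-above {g} g∈ = upClosure⁺ U (G-disjoint g g∈) (∈-members⁺ G g∈) (λ x∈ → x∈)

    -- ⌊ Z ⌋ ∪ (V ∖ U) lies in G and below Z, hence below ⌊ Z ⌋.
    e-⌊⌋ : ∀ {Z} → Z ∈F above → e ⌊ Z ⌋ ≡ e Z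
    e-⌊⌋ {Z} Z∈ = cardE-cong 𝓕 U (⌊⌋-⊆ Z) (proj₁ (upClosure⁻ U (members G) Z∈)) absorbed
      where
      absorbed : ∀ V → V ∈F 𝓕 → V ⊆ Z ∪ U → V ⊆ ⌊ Z ⌋ ∪ U
      absorbed V V∈ V⊆Z∪U {x} x∈V with x SP.∈? U
      ... | yes x∈U = SP.q⊆p∪q ⌊ Z ⌋ U x∈U
      ... | no  x∉U = SP.p⊆p∪q U
        (⊆-⌊⌋ (G-absorbs ⌊ Z ⌋ V (⌊⌋-∈ Z∈) V∈) (∪-least (⌊⌋-⊆ Z) (⊆∪⇒─⊆ V⊆Z∪U))
              (SP.q⊆p∪q ⌊ Z ⌋ (V ─ U) (SP.x∈p∧x∉q⇒x∈p─q x∈V x∉U)))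

    fibre : Subset n → Family n
    fibre g Z = above Z ∧ does (g ≟S ⌊ Z ⌋)

    fibreSize : Subset n → ℕ
    fibreSize g = ∑ᶠ (fibre g) (λ _ → 1)

    ∑-by-fibres : ∀ (𝒜 : Family n) (h : Subset n → ℕ) →
                  ∑ (λ Z → when (above Z ∧ 𝒜 ⌊ Z ⌋) (h ⌊ Z ⌋)) ≡ ∑ᶠ 𝒜 (λ g → h g * fibreSize g)
    ∑-by-fibres 𝒜 h = trans (∑-fibres ⌊_⌋ (λ Z g → when (above Z ∧ 𝒜 g) (h g)))
                            (∑ₗ-cong (subsets n) λ g → trans (∑ₗ-cong (subsets n) (λ Z → reorder _ (above Z) (𝒜 g) (h g)))
                                                             (pull (𝒜 g) (h g) _))
      where
      reorder : ∀ d u b x → when d (when (u ∧ b) x) ≡ when b (x * when (u ∧ d) 1)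
      reorder true  true  true  x = sym (ℕP.*-identityʳ x)
      reorder false true  true  x = sym (ℕP.*-zeroʳ x)
      reorder d     false true  x = trans (when-zero d) (sym (ℕP.*-zeroʳ x))
      reorder true  true  false _ = refl
      reorder true  false false _ = refl
      reorder false _     false _ = refl
      pull : ∀ b x (c : Subset n → ℕ) → ∑ (λ Z → when b (x * c Z)) ≡ when b (x * ∑ c)
      pull true  x c = sym (*-distribˡ-∑ₗ (subsets n) x c)
      pull false _ _ = ∑ₗ-zero (subsets n) (λ _ → refl)

    fibreSize-pos : ∀ {g} → g ∈F G → 1 ≤ fibreSize g
    fibreSize-pos {g} g∈ = subst (_≤ fibreSize g) (cong (λ b → when b 1) g∈fibre) (term≤∑ (λ Z → when (fibre g Z) 1) g)
      where
      g∈fibre : g ∈F fibre g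
      g∈fibre = ∧-intro (∈-above g∈) (dec-true (g ≟S ⌊ g ⌋) (sym (⌊⌋-self g∈)))

    fibreSize≤ : ∀ g → fibreSize g ≤ length (subsets n)
    fibreSize≤ g = ∑ₗ-count≤length (subsets n) (fibre g)

    -- Z ↦ g ∪ (Z ∖ g′) embeds the fibre of g′ into the fibre of g, with left inverse W ↦ W ∪ g′.
    fibreSize-antitone : ∀ {g g′} → g ∈F G → g ⊆ g′ → fibreSize g′ ≤ fibreSize g
    fibreSize-antitone {g} {g′} g∈ g⊆g′ = count-≤-injection (fibre g′) (fibre g) (λ Z → g ∪ (Z ─ g′)) (_∪ g′) embed
      where
      embed : ∀ Z → Z ∈F fibre g′ → g ∪ (Z ─ g′) ∈F fibre g × (g ∪ (Z ─ g′)) ∪ g′ ≡ Z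
      embed Z Z∈ = ∧-intro (upClosure⁺ U (⊆-disjoint Y⊆Z Z∩U) (∈-members⁺ G g∈) (SP.p⊆p∪q _))
                           (dec-true (g ≟S ⌊ Y ⌋) (SP.⊆-antisym (⊆-⌊⌋ g∈ (SP.p⊆p∪q _)) ⌊Y⌋⊆g))
                 , ∪-─-∪-cancel g⊆g′ g′⊆Z
        where
        Z∩U : Z ∩ U ≡ ⊥
        Z∩U = proj₁ (upClosure⁻ U (members G) (∧-conicalˡ _ _ Z∈))
        g′≡⌊Z⌋ : g′ ≡ ⌊ Z ⌋
        g′≡⌊Z⌋ = does⇒ (g′ ≟S ⌊ Z ⌋) (∧-conicalʳ _ _ Z∈)
        g′⊆Z : g′ ⊆ Z
        g′⊆Z = subst (_⊆ Z) (sym g′≡⌊Z⌋) (⌊⌋-⊆ Z)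
        Y : Subset n
        Y = g ∪ (Z ─ g′)
        Y⊆Z : Y ⊆ Z
        Y⊆Z = ∪-least (g′⊆Z ∘ g⊆g′) (SP.p─q⊆p Z g′)
        ⌊Y⌋⊆g : ⌊ Y ⌋ ⊆ g
        ⌊Y⌋⊆g x∈ = ∪-─-∩⊆ g g′ Z (⌊⌋-⊆ Y x∈) (subst (_ ∈_) (sym g′≡⌊Z⌋) (⌊⌋-mono Y⊆Z x∈))

    candidate-upSetIn : ∀ {𝒜} → UpSetIn G 𝒜 → NonemptyFamily 𝒜 →
                        ∀ Z → candidate (members 𝒜) Z ≡ (above Z ∧ 𝒜 ⌊ Z ⌋)
    candidate-upSetIn {𝒜} (𝒜⊆G , 𝒜-up) (a₀ , a₀∈) Z = ≡true-ext to from
      where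
      from⌊⌋ : ∀ {a} → a ∈F 𝒜 → a ⊆ Z → Z ∩ U ≡ ⊥ → (above Z ∧ 𝒜 ⌊ Z ⌋) ≡ true
      from⌊⌋ a∈ a⊆Z Z∩U = let Z∈ = upClosure⁺ U Z∩U (∈-members⁺ G (𝒜⊆G _ a∈)) a⊆Z in
        ∧-intro Z∈ (𝒜-up _ ⌊ Z ⌋ a∈ (⌊⌋-∈ Z∈) (⊆-⌊⌋ (𝒜⊆G _ a∈) a⊆Z))
      to : Z ∈F candidate (members 𝒜) → (above Z ∧ 𝒜 ⌊ Z ⌋) ≡ true
      to Z∈ with upClosure⁻ U (∁ U ∷ members 𝒜) Z∈
      ... | Z∩U , _ , here refl , ∁U⊆Z =
        from⌊⌋ a₀∈ (∁U⊆Z ∘ disjoint⇒⊆∁ (G-disjoint a₀ (𝒜⊆G a₀ a₀∈))) Z∩U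
      ... | Z∩U , X , there X∈ , X⊆Z  = from⌊⌋ (∈-members⁻ 𝒜 X∈) X⊆Z Z∩U
      from : (above Z ∧ 𝒜 ⌊ Z ⌋) ≡ true → Z ∈F candidate (members 𝒜)
      from Z∈ = upClosure⁺ U {∁ U ∷ members 𝒜} (proj₁ (upClosure⁻ U (members G) (∧-conicalˡ _ _ Z∈)))
                             (there (∈-members⁺ 𝒜 (∧-conicalʳ _ _ Z∈))) (⌊⌋-⊆ Z)

    module _ {𝒜 : Family n} (𝒜-upSet : UpSetIn G 𝒜) (𝒜-nonempty : NonemptyFamily 𝒜) where

      num-upSetIn : num (members 𝒜) ≡ ∑ᶠ 𝒜 (λ g → e g * fibreSize g)
      num-upSetIn = begin
        ∑ᶠ (candidate (members 𝒜)) e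
          ≡⟨ ∑ᶠ-congᶠ e (candidate-upSetIn 𝒜-upSet 𝒜-nonempty) ⟩
        ∑ (λ Z → when (above Z ∧ 𝒜 ⌊ Z ⌋) (e Z))
          ≡⟨ ∑ᶠ-cong (λ Z → above Z ∧ 𝒜 ⌊ Z ⌋) (λ Z Z∈ → sym (e-⌊⌋ (∧-conicalˡ _ _ Z∈))) ⟩
        ∑ (λ Z → when (above Z ∧ 𝒜 ⌊ Z ⌋) (e ⌊ Z ⌋))
          ≡⟨ ∑-by-fibres 𝒜 e ⟩
        ∑ᶠ 𝒜 (λ g → e g * fibreSize g) ∎
        where open ≡-Reasoning

      den-upSetIn : den (members 𝒜) ≡ ∑ᶠ 𝒜 fibreSize
      den-upSetIn = begin
        ∑ᶠ (candidate (members 𝒜)) (λ _ → 1)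
          ≡⟨ ∑ᶠ-congᶠ (λ _ → 1) (candidate-upSetIn 𝒜-upSet 𝒜-nonempty) ⟩
        ∑ (λ Z → when (above Z ∧ 𝒜 ⌊ Z ⌋) 1)
          ≡⟨ ∑-by-fibres 𝒜 (λ _ → 1) ⟩
        ∑ᶠ 𝒜 (λ g → 1 * fibreSize g)
          ≡⟨ ∑ᶠ-cong 𝒜 (λ g _ → ℕP.*-identityˡ (fibreSize g)) ⟩
        ∑ᶠ 𝒜 fibreSize ∎
        where open ≡-Reasoning

    upSet-bound : ∀ 𝒜 → UpSetIn G 𝒜 → num best * ∑ᶠ 𝒜 fibreSize ≤ den best * ∑ᶠ 𝒜 (λ g → e g * fibreSize g)
    upSet-bound 𝒜 𝒜-upSet with ∑ᶠ≡0⊎nonempty 𝒜 fibreSize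
    ... | inj₁ ∑≡0 rewrite ∑≡0 | ℕP.*-zeroʳ (num best) = z≤n
    ... | inj₂ 𝒜-nonempty =
      subst₂ _≤_ (cong (num best *_) (den-upSetIn 𝒜-upSet 𝒜-nonempty))
                 (trans (cong (_* den best) (num-upSetIn 𝒜-upSet 𝒜-nonempty)) (ℕP.*-comm _ (den best)))
                 (best-minimal 𝒜)

    N : ℕ
    N = length (subsets n)

    -- On G this is N! / fibreSize g; the suc ∘ pred only makes the division total off G.
    ν : Subset n → ℕ
    ν g = (N !) / suc (pred (fibreSize g))

    fibreSize*ν : ∀ {g} → g ∈F G → fibreSize g * ν g ≡ N !
    fibreSize*ν {g} g∈ = trans (cong (_* ν g) (sym fibreSize⁺≡))
                               (m*[n/m]≡n (∣-! (s≤s z≤n) (subst (_≤ N) (sym fibreSize⁺≡) (fibreSize≤ g))))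
      where
      fibreSize⁺≡ : suc (pred (fibreSize g)) ≡ fibreSize g
      fibreSize⁺≡ = ℕP.suc-pred (fibreSize g) {{ℕ.>-nonZero (fibreSize-pos g∈)}}

    ν-mono : ∀ g g′ → g ∈F G → g′ ∈F G → g ⊆ g′ → ν g ≤ ν g′
    ν-mono g g′ g∈ _ g⊆g′ = /-monoʳ-≤ (N !) (s≤s (ℕP.pred-mono-≤ (fibreSize-antitone g∈ g⊆g′)))

    ∑ᶠ-rescaled : ∀ f → ∑ᶠ G (λ g → f g * (fibreSize g * ν g)) ≡ N ! * ∑ᶠ G f
    ∑ᶠ-rescaled f = trans (∑ᶠ-cong G λ g g∈ → trans (cong (f g *_) (fibreSize*ν g∈)) (ℕP.*-comm (f g) (N !)))
                          (sym (*-distribˡ-∑ᶠ G (N !) f))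

    μ-bound : num best * ∑ᶠ G (λ _ → 1) ≤ den best * ∑ᶠ G e
    μ-bound = ℕP.*-cancelˡ-≤ (N !) {{N ℕP.!≢0}}
      (subst₂ _≤_ (rescale (num best) (λ _ → 1) (λ g → sym (ℕP.*-identityˡ _)))
                  (rescale (den best) e (λ g → ℕP.*-assoc (e g) _ _))
                  cake)
      where
      cake : num best * ∑ᶠ G (λ g → fibreSize g * ν g) ≤ den best * ∑ᶠ G (λ g → e g * fibreSize g * ν g)
      cake = layer-cake G (num best) (den best) fibreSize (λ g → e g * fibreSize g) upSet-bound (N !) ν ν-mono
                        (λ g → m/n≤m (N !) (suc (pred (fibreSize g))))
      rescale : ∀ c f {h} → (∀ g → h g ≡ f g * (fibreSize g * ν g)) → c * ∑ᶠ G h ≡ N ! * (c * ∑ᶠ G f)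
      rescale c f h≡ = trans (cong (c *_) (trans (∑ₗ-cong (subsets n) (λ g → cong (when (G g)) (h≡ g))) (∑ᶠ-rescaled f)))
                             (*-commute c (N !) (∑ᶠ G f))
        where open import Algebra.Properties.CommutativeSemigroup ℕP.*-commutativeSemigroup
                using () renaming (x∙yz≈y∙xz to *-commute)

  𝓗*-upSet : UpSetOfComplement U 𝓗*
  𝓗*-upSet = upClosure-upSet U (∁ U ∷ best)

  𝓗*-nonempty : NonemptyFamily 𝓗*
  𝓗*-nonempty = ∁ U , ∁U∈candidate best

  module _ (⊥∈𝓕 : ⊥ ∈F 𝓕) where

    μnum-𝓗* : μnum 𝓕 U (𝓕 ∨F 𝓗*) ≡ num best
    μnum-𝓗* = trans (μnum≡∑ᶠ 𝓕 U (𝓕 ∨F 𝓗*)) (∑ᶠ-congᶠ e (∨F-∖F-upSet U 𝓕 𝓗* ⊥∈𝓕 𝓗*-upSet))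

    μden-𝓗* : μden 𝓕 U (𝓕 ∨F 𝓗*) ≡ den best
    μden-𝓗* = trans (μden≡∑ᶠ 𝓕 U (𝓕 ∨F 𝓗*))
                    (∑ᶠ-congᶠ (λ _ → 1) (∨F-∖F-upSet U 𝓕 𝓗* ⊥∈𝓕 𝓗*-upSet))

    𝓗*-minimizes : UnionClosed 𝓕 → MinimizesMu 𝓕 U 𝓗*
    𝓗*-minimizes uc𝓕 𝓗 (_ , uc𝓗 , _) =
      subst₂ _≤_ (sym (cong₂ _*_ μnum-𝓗* (μden≡∑ᶠ 𝓕 U (𝓕 ∨F 𝓗))))
                 (trans (ℕP.*-comm (den best) _) (sym (cong₂ _*_ (μnum≡∑ᶠ 𝓕 U (𝓕 ∨F 𝓗)) μden-𝓗*)))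
                 μ-bound
      where
      open Comparison ((𝓕 ∨F 𝓗) ∖F U) (trace-disjoint 𝓕 𝓗 U)
                      (trace-unionClosed 𝓕 𝓗 U uc𝓕 uc𝓗) (trace-absorbs 𝓕 𝓗 U uc𝓕)

theorem3p13 : (n : ℕ) (𝓕 : Family n) (U : Subset n) →
    UnionClosed 𝓕 → ⊥ ∈F 𝓕 → U ⊆ bigUnion 𝓕 →
    Σ (Family n) λ 𝓗 →
      ExtensionFamily 𝓕 U 𝓗 ×
      (UpSetOfComplement U 𝓗 × NonemptyFamily 𝓗) ×
      (∀ X → ((𝓕 ∨F 𝓗) ∖F U) X ≡ 𝓗 X) ×
      MinimizesMu 𝓕 U 𝓗
theorem3p13 n 𝓕 U uc𝓕 ⊥∈𝓕 _ =
  𝓗* , upSet⇒extension U 𝓕 𝓗* 𝓗*-upSet 𝓗*-nonempty , (𝓗*-upSet , 𝓗*-nonempty) ,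
  ∨F-∖F-upSet U 𝓕 𝓗* ⊥∈𝓕 𝓗*-upSet , 𝓗*-minimizes ⊥∈𝓕 uc𝓕
  where open Extremal 𝓕 U
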